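{- Let $n\ge1$ be an integer, $V=\{u\in\mathbb{Z}^3:\sum_{i=1}^3|u_i|=n\}$, $E'=\{\{v,w\}\subset V: v\ne w,\ |v_i-w_i|\le1\ \forall i\}$, and let $d_{uw}$ denote the shortest-path distance between $u$ and $w$ in the undirected graph $G'_n=(V,E')$. For $u\in V$ let $Z_u=\left(\sum_{w\in V\setminus\{u\}} d_{uw}^{ -2}\right)^{ -1}$. Then for every $u\in V$, $Z_u<\dfrac{1}{\ln(n+1)}$. -}

module Defs where

open import Data.Nat as ℕ using (ℕ; zero; suc)
open import Data.Integer as ℤ using (ℤ; +_; ∣_∣)
open import Data.Rational as ℚ using (ℚ; 0ℚ; 1ℚ)
open import Data.Product using (_×_; _,_; ∃)
open import Data.Product.Properties using (≡-dec)
open import Data.List using (List; []; _∷_; map; concatMap; filter; upTo; foldr)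
open import Relation.Binary.PropositionalEquality using (_≡_; _≢_)
open import Relation.Binary.Definitions using (DecidableEquality)
open import Relation.Nullary.Negation using (¬_)
open import Relation.Nullary.Decidable using (¬?)

Pt : Set
Pt = ℤ × ℤ × ℤ

_≟Pt_ : DecidableEquality Pt
_≟Pt_ = ≡-dec ℤ._≟_ (≡-dec ℤ._≟_ ℤ._≟_)

norm1 : Pt → ℕ
norm1 (a , b , c) = ∣ a ∣ ℕ.+ ∣ b ∣ ℕ.+ ∣ c ∣

InV : ℕ → Pt → Set
InV n u = norm1 u ≡ n

Adj : Pt → Pt → Set
Adj (a , b , c) (a' , b' , c') =
  ((a , b , c) ≢ (a' , b' , c')) ×
  (∣ a ℤ.- a' ∣ ℕ.≤ 1) × (∣ b ℤ.- b' ∣ ℕ.≤ 1) × (∣ c ℤ.- c' ∣ ℕ.≤ 1)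

-- Walk n u w k : a walk of length k from u to w in G'_n
-- (all vertices after u lie in V; u itself is required to lie in V by users)
data Walk (n : ℕ) : Pt → Pt → ℕ → Set where
  here : ∀ {u} → Walk n u u 0
  step : ∀ {u v w k} → InV n v → Adj u v → Walk n v w k → Walk n u w (suc k)

IsDist : ℕ → Pt → Pt → ℕ → Set
IsDist n u w k = Walk n u w k × (∀ j → Walk n u w j → k ℕ.≤ j)

range : ℕ → List ℤ
range n = map (λ i → (+ i) ℤ.- (+ n)) (upTo (suc (2 ℕ.* n)))

box : ℕ → List Pt
box n = concatMap (λ a → concatMap (λ b → map (λ c → (a , b , c)) (range n)) (range n)) (range n)

Vlist : ℕ → List Pt
Vlist n = filter (λ p → norm1 p ℕ.≟ n) (box n)

Vminus : ℕ → Pt → List Pt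
Vminus n u = filter (λ w → ¬? (w ≟Pt u)) (Vlist n)

-- d ↦ d⁻² (the value at 0 is irrelevant: distances to w ≠ u are positive)
recipSq : ℕ → ℚ
recipSq zero = 0ℚ
recipSq (suc k) = (+ 1) ℚ./ (suc k ℕ.* suc k)

sumℚ : List ℚ → ℚ
sumℚ = foldr ℚ._+_ 0ℚ

expTerm : ℚ → ℕ → ℚ
expTerm S zero = 1ℚ
expTerm S (suc k) = expTerm S k ℚ.* S ℚ.* ((+ 1) ℚ./ suc k)

expPartial : ℚ → ℕ → ℚ
expPartial S zero = 0ℚ
expPartial S (suc k) = expPartial S k ℚ.+ expTerm S k

-- "ln y < S" for a natural y ≥ 1 and rational S ≥ 0:
-- equivalently y < exp S = sup_k Σ_{j<k} S^j/j!
LnLt : ℕ → ℚ → Set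
LnLt y S = ∃ λ k → (+ y) ℚ./ 1 ℚ.< expPartial S k

-- Write u = (a, b, c) and A = |a|, B = |b|, C = |c|, so A + B + C = n.  After reflecting
-- coordinates we may take u = (A, B, C).  For i < A the i + 2 points
--   (A - (i+1), B + j, C + (i+1-j)),   j ≤ i + 1,
-- are vertices at distance at most i + 1 from u (move j units from the first coordinate to
-- the second, then the rest to the third), so this "cone" contributes at least
--   coneBound A = Σ_{i<A} (i+2)/(i+1)²
-- to Z_u⁻¹.  The analogous cones for the second and third coordinate are disjoint from it,
-- whence Z_u⁻¹ ≥ coneBound A + coneBound B + coneBound C.  Since 1 + (i+2)/(i+1)² ≥
-- (i+2)/(i+1), exp (coneBound X) ≥ X + 1, and therefore
--   exp Z_u⁻¹ ≥ (A+1)(B+1)(C+1) ≥ n + 1,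
-- strictly.  As ℚ has no exponential, exp is handled through its partial sums (LnLt).
module Submission where

open import Defs
open import Level using (0ℓ)
open import Data.List using (List; []; _∷_; map; applyDownFrom; _++_; concat; concatMap; [_])
open import Data.Product using (_×_; _,_; ∃; ∃₂; proj₁; proj₂)
open import Data.Nat as ℕ using (ℕ; zero; suc; z≤n; s≤s; _∸_)
import Data.Nat.Properties as ℕP
open import Data.Integer as ℤ using (ℤ; +_; -[1+_]; ∣_∣; _⊖_)
import Data.Integer.Properties as ℤP
open import Data.Nat.Tactic.RingSolver renaming (solve-∀ to ℕ-solve-∀)
open import Data.Integer.Tactic.RingSolver renaming (solve-∀ to ℤ-solve-∀)
open import Data.Rational as ℚ using (ℚ; 0ℚ; 1ℚ; _+_; _*_; _≤_; _<_; toℚᵘ)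
import Data.Rational.Properties as ℚP
open ℚP using (≤-refl; ≤-trans; ≤-reflexive; +-mono-≤)
import Data.Rational.Unnormalised as ℚᵘ
open ℚᵘ using (mkℚᵘ; *≡*; *≤*)
import Data.Rational.Unnormalised.Properties as ℚᵘP
open import Tactic.RingSolver using (solve-∀)
open import Tactic.RingSolver.Core.AlmostCommutativeRing using (AlmostCommutativeRing; fromCommutativeRing)
open import Data.List.Membership.Propositional using (_∈_; lose)
open import Data.List.Membership.Propositional.Properties
open import Data.List.Relation.Unary.Any using (here; there)
import Data.List.Relation.Unary.All as All
open import Data.List.Relation.Unary.AllPairs using (_∷_)
import Data.List.Relation.Unary.All.Properties as AllP
import Data.List.Relation.Unary.AllPairs.Properties as AllPairsP
import Data.List.Relation.Unary.Unique.Propositional.Properties as Unique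
open import Data.List.Relation.Binary.Disjoint.Propositional using (Disjoint)
import Data.List.Properties as LP
open import Data.List.Relation.Unary.Unique.Propositional using (Unique)
open import Data.Sum using (inj₁; inj₂)
open import Data.Sign as Sign using (Sign)
open import Data.Empty using (⊥-elim)
open import Function using (_∘_)
open import Relation.Binary.PropositionalEquality hiding ([_])
open import Relation.Nullary.Decidable using (dec⇒maybe; ¬?)

ℚ-ring : AlmostCommutativeRing 0ℓ 0ℓ
ℚ-ring = fromCommutativeRing ℚP.+-*-commutativeRing (λ x → dec⇒maybe (0ℚ ℚ.≟ x))

variable
  p q r : ℚ

nonNeg-+ : 0ℚ ≤ p → 0ℚ ≤ q → 0ℚ ≤ p + q
nonNeg-+ {p} {q} 0≤p 0≤q = ℚP.nonNegative⁻¹ (p + q)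
  {{ℚP.nonNeg+nonNeg⇒nonNeg p {{ℚ.nonNegative 0≤p}} q {{ℚ.nonNegative 0≤q}}}}

nonNeg-* : 0ℚ ≤ p → 0ℚ ≤ q → 0ℚ ≤ p * q
nonNeg-* {p} {q} 0≤p 0≤q = ℚP.nonNegative⁻¹ (p * q)
  {{ℚP.nonNeg*nonNeg⇒nonNeg p {{ℚ.nonNegative 0≤p}} q {{ℚ.nonNegative 0≤q}}}}

pos-* : 0ℚ < p → 0ℚ < q → 0ℚ < p * q
pos-* {p} {q} 0<p 0<q = ℚP.positive⁻¹ (p * q) {{ℚP.pos*pos⇒pos p {{ℚ.positive 0<p}} q {{ℚ.positive 0<q}}}}

pos-+ : 0ℚ < p → 0ℚ ≤ q → 0ℚ < p + q
pos-+ {p} {q} 0<p 0≤q = ℚP.positive⁻¹ (p + q) {{ℚP.pos+nonNeg⇒pos p {{ℚ.positive 0<p}} q {{ℚ.nonNegative 0≤q}}}}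

p≤p+q : ∀ p → 0ℚ ≤ q → p ≤ p + q
p≤p+q p 0≤q = ≤-trans (≤-reflexive (sym (ℚP.+-identityʳ p))) (ℚP.+-monoʳ-≤ p 0≤q)

p<p+q : ∀ p → 0ℚ < q → p < p + q
p<p+q p 0<q = ℚP.≤-<-trans (≤-reflexive (sym (ℚP.+-identityʳ p))) (ℚP.+-monoʳ-< p 0<q)

*-monoˡ : 0ℚ ≤ r → p ≤ q → r * p ≤ r * q
*-monoˡ {r} 0≤r = ℚP.*-monoˡ-≤-nonNeg r {{ℚ.nonNegative 0≤r}}

*-monoʳ : 0ℚ ≤ r → p ≤ q → p * r ≤ q * r
*-monoʳ {r} 0≤r = ℚP.*-monoʳ-≤-nonNeg r {{ℚ.nonNegative 0≤r}}

-- The embedding ℕ → ℚ, by recursion so that its laws are proved by induction.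
fromℕ : ℕ → ℚ
fromℕ zero    = 0ℚ
fromℕ (suc m) = 1ℚ + fromℕ m

fromℕ-+ : ∀ a b → fromℕ (a ℕ.+ b) ≡ fromℕ a + fromℕ b
fromℕ-+ zero    b = sym (ℚP.+-identityˡ (fromℕ b))
fromℕ-+ (suc a) b = trans (cong (λ x → 1ℚ + x) (fromℕ-+ a b)) (sym (ℚP.+-assoc 1ℚ (fromℕ a) (fromℕ b)))

fromℕ-* : ∀ a b → fromℕ (a ℕ.* b) ≡ fromℕ a * fromℕ b
fromℕ-* zero    b = sym (ℚP.*-zeroˡ (fromℕ b))
fromℕ-* (suc a) b = begin
  fromℕ (b ℕ.+ a ℕ.* b)         ≡⟨ fromℕ-+ b (a ℕ.* b) ⟩
  fromℕ b + fromℕ (a ℕ.* b)     ≡⟨ cong (λ x → fromℕ b + x) (fromℕ-* a b) ⟩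
  fromℕ b + fromℕ a * fromℕ b   ≡⟨ distrib (fromℕ a) (fromℕ b) ⟩
  (1ℚ + fromℕ a) * fromℕ b      ∎
  where
  open ≡-Reasoning
  distrib : ∀ x y → y + x * y ≡ (1ℚ + x) * y
  distrib = solve-∀ ℚ-ring

fromℕ-nonNeg : ∀ m → 0ℚ ≤ fromℕ m
fromℕ-nonNeg zero    = ≤-refl
fromℕ-nonNeg (suc m) = nonNeg-+ (ℚP.nonNegative⁻¹ 1ℚ) (fromℕ-nonNeg m)

fromℕ-mono : ∀ {a b} → a ℕ.≤ b → fromℕ a ≤ fromℕ b
fromℕ-mono {a} a≤b with k , refl ← ℕP.m≤n⇒∃[o]m+o≡n a≤b =
  ≤-trans (p≤p+q (fromℕ a) (fromℕ-nonNeg k)) (≤-reflexive (sym (fromℕ-+ a k)))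

toℚᵘ-fromℕ : ∀ m → toℚᵘ (fromℕ m) ℚᵘ.≃ mkℚᵘ (+ m) 0
toℚᵘ-fromℕ zero    = ℚᵘP.≃-refl
toℚᵘ-fromℕ (suc m) = ℚᵘP.≃-trans (ℚP.toℚᵘ-homo-+ 1ℚ (fromℕ m))
  (ℚᵘP.≃-trans (ℚᵘP.+-congʳ (toℚᵘ 1ℚ) (toℚᵘ-fromℕ m)) (*≡* (numerator m)))
  where
  normalise : ∀ x → (+ 1 ℤ.* + 1 ℤ.+ x ℤ.* + 1) ℤ.* + 1 ≡ (+ 1 ℤ.+ x) ℤ.* (+ 1 ℤ.* + 1)
  normalise = ℤ-solve-∀
  numerator : ∀ m → (+ 1 ℤ.* + 1 ℤ.+ + m ℤ.* + 1) ℤ.* + 1 ≡ + suc m ℤ.* (+ 1 ℤ.* + 1)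
  numerator m = trans (normalise (+ m)) (cong (ℤ._* (+ 1 ℤ.* + 1)) (sym (ℤP.pos-+ 1 m)))

fromℕ≡/1 : ∀ m → fromℕ m ≡ (+ m) ℚ./ 1
fromℕ≡/1 m = ℚP.toℚᵘ-injective (ℚᵘP.≃-trans (toℚᵘ-fromℕ m) (ℚᵘP.≃-sym (ℚP.toℚᵘ-fromℚᵘ (mkℚᵘ (+ m) 0))))

/-inverse : ∀ j → ((+ 1) ℚ./ suc j) * fromℕ (suc j) ≡ 1ℚ
/-inverse j = ℚP.toℚᵘ-injective (ℚᵘP.≃-trans (ℚP.toℚᵘ-homo-* ((+ 1) ℚ./ suc j) (fromℕ (suc j)))
  (ℚᵘP.≃-trans (ℚᵘP.*-cong (ℚP.toℚᵘ-fromℚᵘ (mkℚᵘ (+ 1) j)) (toℚᵘ-fromℕ (suc j)))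
               (ℚᵘP.*-inverseˡ (mkℚᵘ (+ suc j) 0))))

reciprocal-pos : ∀ j → 0ℚ < (+ 1) ℚ./ suc j
reciprocal-pos j = ℚP.positive⁻¹ _ {{ℚP.normalize-pos 1 (suc j)}}

reciprocal-nonNeg : ∀ j → 0ℚ ≤ (+ 1) ℚ./ suc j
reciprocal-nonNeg j = ℚP.<⇒≤ (reciprocal-pos j)

recipSq-nonNeg : ∀ k → 0ℚ ≤ recipSq k
recipSq-nonNeg zero    = ≤-refl
recipSq-nonNeg (suc k) = reciprocal-nonNeg (k ℕ.+ k ℕ.* suc k)

recipSq-pos : ∀ k → 0ℚ < recipSq (suc k)
recipSq-pos k = reciprocal-pos (k ℕ.+ k ℕ.* suc k)

recipSq-antitone : ∀ {k m} → k ℕ.≤ m → recipSq (suc m) ≤ recipSq (suc k)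
recipSq-antitone {k} {m} k≤m = ℚP.toℚᵘ-cancel-≤
  (ℚᵘP.≤-respʳ-≃ (ℚᵘP.≃-sym (ℚP.toℚᵘ-fromℚᵘ (mkℚᵘ (+ 1) (k ℕ.+ k ℕ.* suc k))))
  (ℚᵘP.≤-respˡ-≃ (ℚᵘP.≃-sym (ℚP.toℚᵘ-fromℚᵘ (mkℚᵘ (+ 1) (m ℕ.+ m ℕ.* suc m))))
     (*≤* (ℤ.+≤+ (ℕP.*-monoʳ-≤ 1 (ℕP.*-mono-≤ (s≤s k≤m) (s≤s k≤m)))))))

recipSq-inverse : ∀ k → recipSq (suc k) * (fromℕ (suc k) * fromℕ (suc k)) ≡ 1ℚ
recipSq-inverse k = trans (cong (recipSq (suc k) *_) (sym (fromℕ-* (suc k) (suc k))))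
                          (/-inverse (k ℕ.+ k ℕ.* suc k))

expTerm-nonNeg : 0ℚ ≤ p → ∀ k → 0ℚ ≤ expTerm p k
expTerm-nonNeg 0≤p zero    = ℚP.nonNegative⁻¹ 1ℚ
expTerm-nonNeg 0≤p (suc k) =
  nonNeg-* (nonNeg-* (expTerm-nonNeg 0≤p k) 0≤p) (reciprocal-nonNeg k)

expTerm-pos : 0ℚ < p → ∀ k → 0ℚ < expTerm p k
expTerm-pos 0<p zero    = ℚP.positive⁻¹ 1ℚ
expTerm-pos 0<p (suc k) =
  pos-* (pos-* (expTerm-pos 0<p k) 0<p) (reciprocal-pos k)

expTerm-mono : 0ℚ ≤ p → p ≤ q → ∀ k → expTerm p k ≤ expTerm q k
expTerm-mono 0≤p p≤q zero    = ≤-refl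
expTerm-mono 0≤p p≤q (suc k) = *-monoʳ (reciprocal-nonNeg k)
  (≤-trans (*-monoʳ 0≤p (expTerm-mono 0≤p p≤q k)) (*-monoˡ (expTerm-nonNeg (≤-trans 0≤p p≤q) k) p≤q))

expPartial-nonNeg : 0ℚ ≤ p → ∀ K → 0ℚ ≤ expPartial p K
expPartial-nonNeg 0≤p zero    = ≤-refl
expPartial-nonNeg 0≤p (suc K) = nonNeg-+ (expPartial-nonNeg 0≤p K) (expTerm-nonNeg 0≤p K)

expPartial-mono : 0ℚ ≤ p → p ≤ q → ∀ K → expPartial p K ≤ expPartial q K
expPartial-mono 0≤p p≤q zero    = ≤-refl
expPartial-mono 0≤p p≤q (suc K) = +-mono-≤ (expPartial-mono 0≤p p≤q K) (expTerm-mono 0≤p p≤q K)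

expTerm-suc : ∀ x k → expTerm x (suc k) * fromℕ (suc k) ≡ expTerm x k * x
expTerm-suc x k = begin
  expTerm x k * x * c * fromℕ (suc k)    ≡⟨ ℚP.*-assoc (expTerm x k * x) c (fromℕ (suc k)) ⟩
  expTerm x k * x * (c * fromℕ (suc k))  ≡⟨ cong (expTerm x k * x *_) (/-inverse k) ⟩
  expTerm x k * x * 1ℚ                   ≡⟨ ℚP.*-identityʳ (expTerm x k * x) ⟩
  expTerm x k * x                        ∎
  where
  open ≡-Reasoning
  c = (+ 1) ℚ./ suc k

-- Two terms of the binomial expansion of (x + y)^(k+1)/(k+1)!:
--   x^(k+1)/(k+1)! + y · x^k/k! ≤ (x + y)^(k+1)/(k+1)!.
expTerm-binomial : ∀ {x y} → 0ℚ ≤ x → 0ℚ ≤ y → ∀ k →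
                   expTerm x (suc k) + y * expTerm x k ≤ expTerm (x + y) (suc k)
expTerm-binomial {x} {y} 0≤x 0≤y zero = ≤-reflexive (simplify x y)
  where
  simplify : ∀ x y → 1ℚ * x * ((+ 1) ℚ./ 1) + y * 1ℚ ≡ 1ℚ * (x + y) * ((+ 1) ℚ./ 1)
  simplify = solve-∀ ℚ-ring
expTerm-binomial {x} {y} 0≤x 0≤y (suc k) = begin
  T₁ * x * c + y * T₁                  ≤⟨ p≤p+q _ (nonNeg-* (nonNeg-* (nonNeg-* 0≤y 0≤y) (expTerm-nonNeg 0≤x k)) 0≤c) ⟩
  T₁ * x * c + y * T₁ + y * y * T₀ * c ≡⟨ regroup ⟩
  (T₁ + y * T₀) * (x + y) * c          ≤⟨ *-monoʳ 0≤c (*-monoʳ (nonNeg-+ 0≤x 0≤y) (expTerm-binomial 0≤x 0≤y k)) ⟩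
  expTerm (x + y) (suc (suc k))        ∎
  where
  open ℚP.≤-Reasoning
  T₀ = expTerm x k
  T₁ = expTerm x (suc k)
  c  = (+ 1) ℚ./ suc (suc k)
  N  = fromℕ (suc k)
  0≤c : 0ℚ ≤ c
  0≤c = reciprocal-nonNeg (suc k)
  -- uses c · (k + 2) = 1 and T₀ · x = T₁ · (k + 1)
  regroup : T₁ * x * c + y * T₁ + y * y * T₀ * c ≡ (T₁ + y * T₀) * (x + y) * c
  regroup = begin-equality
    T₁ * x * c + y * T₁ + y * y * T₀ * c
      ≡⟨ cong (λ z → T₁ * x * c + z + y * y * T₀ * c) (ℚP.*-identityʳ (y * T₁)) ⟨
    T₁ * x * c + y * T₁ * 1ℚ + y * y * T₀ * c
      ≡⟨ cong (λ z → T₁ * x * c + y * T₁ * z + y * y * T₀ * c)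
              (trans (ℚP.*-comm (1ℚ + N) c) (/-inverse (suc k))) ⟨
    T₁ * x * c + y * T₁ * ((1ℚ + N) * c) + y * y * T₀ * c
      ≡⟨ expand T₁ x y c N T₀ ⟩
    T₁ * x * c + y * T₁ * c + y * (T₁ * N) * c + y * y * T₀ * c
      ≡⟨ cong (λ z → T₁ * x * c + y * T₁ * c + y * z * c + y * y * T₀ * c) (expTerm-suc x k) ⟩
    T₁ * x * c + y * T₁ * c + y * (T₀ * x) * c + y * y * T₀ * c
      ≡⟨ factor T₁ x y c T₀ ⟩
    (T₁ + y * T₀) * (x + y) * c ∎
    where
    expand : ∀ T₁ x y c N T₀ → T₁ * x * c + y * T₁ * ((1ℚ + N) * c) + y * y * T₀ * c
                             ≡ T₁ * x * c + y * T₁ * c + y * (T₁ * N) * c + y * y * T₀ * c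
    expand = solve-∀ ℚ-ring
    factor : ∀ T₁ x y c T₀ → T₁ * x * c + y * T₁ * c + y * (T₀ * x) * c + y * y * T₀ * c
                           ≡ (T₁ + y * T₀) * (x + y) * c
    factor = solve-∀ ℚ-ring

expPartial-binomial : ∀ {x y} → 0ℚ ≤ x → 0ℚ ≤ y → ∀ K →
                      expPartial x (suc K) + y * expPartial x K ≤ expPartial (x + y) (suc K)
expPartial-binomial {x} {y} 0≤x 0≤y zero = ≤-reflexive (simplify y)
  where
  simplify : ∀ y → 0ℚ + 1ℚ + y * 0ℚ ≡ 0ℚ + 1ℚ
  simplify = solve-∀ ℚ-ring
expPartial-binomial {x} {y} 0≤x 0≤y (suc K) =
  ≤-trans (≤-reflexive (regroup (expPartial x (suc K)) (expTerm x (suc K)) (expPartial x K) (expTerm x K) y))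
          (+-mono-≤ (expPartial-binomial 0≤x 0≤y K) (expTerm-binomial 0≤x 0≤y K))
  where
  regroup : ∀ e₁ t₁ e₀ t₀ y → e₁ + t₁ + y * (e₀ + t₀) ≡ (e₁ + y * e₀) + (t₁ + y * t₀)
  regroup = solve-∀ ℚ-ring

-- The discrete form of exp (x + y) ≥ (1 + y) · exp x, at the cost of one more term.
expPartial-step : ∀ {x y} → 0ℚ ≤ x → 0ℚ ≤ y → ∀ K →
                  (1ℚ + y) * expPartial x K ≤ expPartial (x + y) (suc K)
expPartial-step {x} {y} 0≤x 0≤y K = begin
  (1ℚ + y) * expPartial x K                   ≡⟨ ℚP.*-distribʳ-+ (expPartial x K) 1ℚ y ⟩
  1ℚ * expPartial x K + y * expPartial x K    ≡⟨ cong (λ z → z + y * expPartial x K) (ℚP.*-identityˡ (expPartial x K)) ⟩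
  expPartial x K + y * expPartial x K         ≤⟨ ℚP.+-monoˡ-≤ (y * expPartial x K) (p≤p+q (expPartial x K) (expTerm-nonNeg 0≤x K)) ⟩
  expPartial x (suc K) + y * expPartial x K   ≤⟨ expPartial-binomial 0≤x 0≤y K ⟩
  expPartial (x + y) (suc K)                  ∎
  where open ℚP.≤-Reasoning

-- The weight of the i-th shell of a cone: i + 2 vertices at distance at most i + 1
-- contribute at least  w i = (i+2)/(i+1)².  A cone of height X contributes at least
-- coneBound X = Σ_{i<X} w i.
shellWeight : ℕ → ℚ
shellWeight i = fromℕ (suc (suc i)) * recipSq (suc i)

coneBound : ℕ → ℚ
coneBound X = sumℚ (applyDownFrom shellWeight X)

shellWeight-pos : ∀ i → 0ℚ < shellWeight i
shellWeight-pos i = pos-* (pos-+ (ℚP.positive⁻¹ 1ℚ) (fromℕ-nonNeg (suc i))) (recipSq-pos i)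

coneBound-nonNeg : ∀ X → 0ℚ ≤ coneBound X
coneBound-nonNeg zero    = ≤-refl
coneBound-nonNeg (suc X) = nonNeg-+ (ℚP.<⇒≤ (shellWeight-pos X)) (coneBound-nonNeg X)

coneBound-pos : ∀ X → 0ℚ < coneBound (suc X)
coneBound-pos X = pos-+ (shellWeight-pos X) (coneBound-nonNeg X)

-- 1 + (i+2)/(i+1)² ≥ (i+2)/(i+1), i.e. exp (w i) ≥ (i+2)/(i+1).
shellWeight-ratio : ∀ i → fromℕ (suc (suc i)) ≤ (1ℚ + shellWeight i) * fromℕ (suc i)
shellWeight-ratio i = begin
  1ℚ + N                   ≤⟨ ℚP.+-monoʳ-≤ 1ℚ (p≤p+q N (nonNeg-* (recipSq-nonNeg (suc i)) (fromℕ-nonNeg (suc i)))) ⟩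
  1ℚ + (N + w * N)         ≡⟨ cong (λ z → z + (N + w * N)) (recipSq-inverse i) ⟨
  w * (N * N) + (N + w * N) ≡⟨ factor N w ⟩
  (1ℚ + (1ℚ + N) * w) * N  ∎
  where
  open ℚP.≤-Reasoning
  N = fromℕ (suc i)
  w = recipSq (suc i)
  factor : ∀ N w → w * (N * N) + (N + w * N) ≡ (1ℚ + (1ℚ + N) * w) * N
  factor = solve-∀ ℚ-ring

-- exp (coneBound X) ≥ X + 1, in partial-sum form:
--   (X + 1) · E s K ≤ E (coneBound X + s) (X + K)   for s ≥ 0.
expPartial-coneBound : ∀ X {s} → 0ℚ ≤ s → ∀ K →
                       fromℕ (suc X) * expPartial s K ≤ expPartial (coneBound X + s) (X ℕ.+ K)
expPartial-coneBound zero {s} 0≤s K = ≤-reflexive (trans (unit (expPartial s K)) (cong (λ z → expPartial z K) (sym (ℚP.+-identityˡ s))))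
  where
  unit : ∀ e → (1ℚ + 0ℚ) * e ≡ e
  unit = solve-∀ ℚ-ring
expPartial-coneBound (suc X) {s} 0≤s K = begin
  fromℕ (suc (suc X)) * e                   ≤⟨ *-monoʳ (expPartial-nonNeg 0≤s K) (shellWeight-ratio X) ⟩
  (1ℚ + w) * fromℕ (suc X) * e              ≡⟨ ℚP.*-assoc (1ℚ + w) (fromℕ (suc X)) e ⟩
  (1ℚ + w) * (fromℕ (suc X) * e)            ≤⟨ *-monoˡ (nonNeg-+ (ℚP.nonNegative⁻¹ 1ℚ) 0≤w) (expPartial-coneBound X 0≤s K) ⟩
  (1ℚ + w) * expPartial (G + s) (X ℕ.+ K)   ≤⟨ expPartial-step (nonNeg-+ (coneBound-nonNeg X) 0≤s) 0≤w (X ℕ.+ K) ⟩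
  expPartial (G + s + w) (suc X ℕ.+ K)      ≡⟨ cong (λ z → expPartial z (suc X ℕ.+ K)) (reorder G s w) ⟩
  expPartial (w + G + s) (suc X ℕ.+ K)      ∎
  where
  open ℚP.≤-Reasoning
  e = expPartial s K
  w = shellWeight X
  G = coneBound X
  0≤w : 0ℚ ≤ w
  0≤w = ℚP.<⇒≤ (shellWeight-pos X)
  reorder : ∀ G s w → G + s + w ≡ w + G + s
  reorder = solve-∀ ℚ-ring

suc-sum≤product : ∀ A B C → suc (A ℕ.+ B ℕ.+ C) ℕ.≤ suc A ℕ.* (suc B ℕ.* suc C)
suc-sum≤product A B C = ℕP.≤-trans (ℕP.m≤m+n (suc (A ℕ.+ B ℕ.+ C)) _) (ℕP.≤-reflexive (expand A B C))
  where
  expand : ∀ A B C → suc (A ℕ.+ B ℕ.+ C) ℕ.+ (A ℕ.* B ℕ.+ A ℕ.* C ℕ.+ B ℕ.* C ℕ.+ A ℕ.* B ℕ.* C)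
                   ≡ suc A ℕ.* (suc B ℕ.* suc C)
  expand = ℕ-solve-∀

coneBounds-pos : ∀ A B C → 1 ℕ.≤ A ℕ.+ B ℕ.+ C → 0ℚ < coneBound A + (coneBound B + coneBound C)
coneBounds-pos (suc A) B C _ =
  pos-+ (coneBound-pos A) (nonNeg-+ (coneBound-nonNeg B) (coneBound-nonNeg C))
coneBounds-pos zero (suc B) C _ =
  ℚP.<-≤-trans (pos-+ (coneBound-pos B) (coneBound-nonNeg C)) (≤-reflexive (sym (ℚP.+-identityˡ _)))
coneBounds-pos zero zero (suc C) _ =
  ℚP.<-≤-trans (coneBound-pos C) (≤-reflexive (sym (trans (ℚP.+-identityˡ _) (ℚP.+-identityˡ _))))

expPartial-coneBound-≥ : ∀ X → fromℕ (suc X) ≤ expPartial (coneBound X) (suc X)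
expPartial-coneBound-≥ X = subst₂ _≤_ (ℚP.*-identityʳ (fromℕ (suc X)))
  (cong₂ expPartial (ℚP.+-identityʳ (coneBound X)) (ℕP.+-comm X 1))
  (expPartial-coneBound X ≤-refl 1)

-- Iterating expPartial-coneBound gives
-- exp (Σ coneBound) ≥ (A+1)(B+1)(C+1) ≥ n + 1, and one further (positive) term of the
-- series makes the inequality strict.
ln-bound : ∀ A B C S → 1 ℕ.≤ A ℕ.+ B ℕ.+ C →
           coneBound A + (coneBound B + coneBound C) ≤ S → LnLt (suc (A ℕ.+ B ℕ.+ C)) S
ln-bound A B C S 1≤n G≤S = suc K , subst (_< expPartial S (suc K)) (fromℕ≡/1 (suc (A ℕ.+ B ℕ.+ C))) (begin-strict
  fromℕ (suc (A ℕ.+ B ℕ.+ C))                              ≤⟨ fromℕ-mono (suc-sum≤product A B C) ⟩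
  fromℕ (suc A ℕ.* (suc B ℕ.* suc C))                      ≡⟨ product ⟩
  fromℕ (suc A) * (fromℕ (suc B) * fromℕ (suc C))          ≤⟨ *-monoˡ (fromℕ-nonNeg (suc A)) (*-monoˡ (fromℕ-nonNeg (suc B)) exp-G₃) ⟩
  fromℕ (suc A) * (fromℕ (suc B) * expPartial G₃ (suc C))  ≤⟨ *-monoˡ (fromℕ-nonNeg (suc A)) exp-G₂₃ ⟩
  fromℕ (suc A) * expPartial (G₂ + G₃) (B ℕ.+ suc C)      ≤⟨ exp-G₁₂₃ ⟩
  expPartial G K                                           <⟨ p<p+q (expPartial G K) (expTerm-pos 0<G K) ⟩
  expPartial G (suc K)                                     ≤⟨ expPartial-mono (ℚP.<⇒≤ 0<G) G≤S (suc K) ⟩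
  expPartial S (suc K)                                     ∎)
  where
  open ℚP.≤-Reasoning
  G₂ = coneBound B
  G₃ = coneBound C
  G = coneBound A + (G₂ + G₃)
  K = A ℕ.+ (B ℕ.+ suc C)
  0<G : 0ℚ < G
  0<G = coneBounds-pos A B C 1≤n
  product : fromℕ (suc A ℕ.* (suc B ℕ.* suc C)) ≡ fromℕ (suc A) * (fromℕ (suc B) * fromℕ (suc C))
  product = trans (fromℕ-* (suc A) (suc B ℕ.* suc C)) (cong (fromℕ (suc A) *_) (fromℕ-* (suc B) (suc C)))
  exp-G₃ : fromℕ (suc C) ≤ expPartial G₃ (suc C)
  exp-G₃ = expPartial-coneBound-≥ C
  exp-G₂₃ : fromℕ (suc B) * expPartial G₃ (suc C) ≤ expPartial (G₂ + G₃) (B ℕ.+ suc C)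
  exp-G₂₃ = expPartial-coneBound B (coneBound-nonNeg C) (suc C)
  exp-G₁₂₃ : fromℕ (suc A) * expPartial (G₂ + G₃) (B ℕ.+ suc C) ≤ expPartial G K
  exp-G₁₂₃ = expPartial-coneBound A (nonNeg-+ (coneBound-nonNeg B) (coneBound-nonNeg C)) (B ℕ.+ suc C)

module _ {A : Set} (f : A → ℚ) where

  sumℚ-++ : ∀ xs ys → sumℚ (map f (xs ++ ys)) ≡ sumℚ (map f xs) + sumℚ (map f ys)
  sumℚ-++ []       ys = sym (ℚP.+-identityˡ _)
  sumℚ-++ (x ∷ xs) ys = trans (cong (λ s → f x + s) (sumℚ-++ xs ys)) (sym (ℚP.+-assoc (f x) _ _))

  sumℚ-concat : ∀ xss → sumℚ (map f (concat xss)) ≡ sumℚ (map (λ xs → sumℚ (map f xs)) xss)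
  sumℚ-concat []         = refl
  sumℚ-concat (xs ∷ xss) = trans (sumℚ-++ xs (concat xss)) (cong (λ s → sumℚ (map f xs) + s) (sumℚ-concat xss))

  module _ (f-nonNeg : ∀ x → 0ℚ ≤ f x) where

    sumℚ-nonNeg : ∀ xs → 0ℚ ≤ sumℚ (map f xs)
    sumℚ-nonNeg []       = ≤-refl
    sumℚ-nonNeg (x ∷ xs) = nonNeg-+ (f-nonNeg x) (sumℚ-nonNeg xs)

    -- For non-negative weights, a duplicate-free list contained in another has the
    -- smaller sum: remove its head from the larger list and recurse.
    sumℚ-⊆ : ∀ {xs ys} → Unique xs → (∀ {v} → v ∈ xs → v ∈ ys) → sumℚ (map f xs) ≤ sumℚ (map f ys)
    sumℚ-⊆ {[]}     {ys} _             _     = sumℚ-nonNeg ys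
    sumℚ-⊆ {x ∷ xs} {ys} (x∉xs ∷ uniq) xs⊆ys with zs₁ , zs₂ , refl ← ∈-∃++ (xs⊆ys (here refl)) = begin
      f x + sumℚ (map f xs)                                     ≤⟨ ℚP.+-monoʳ-≤ (f x) (sumℚ-⊆ uniq xs⊆zs) ⟩
      f x + sumℚ (map f (zs₁ ++ zs₂))                           ≡⟨ cong (λ s → f x + s) (sumℚ-++ zs₁ zs₂) ⟩
      f x + (sumℚ (map f zs₁) + sumℚ (map f zs₂))               ≡⟨ swap (f x) (sumℚ (map f zs₁)) (sumℚ (map f zs₂)) ⟩
      sumℚ (map f zs₁) + (f x + sumℚ (map f zs₂))               ≡⟨ sumℚ-++ zs₁ (x ∷ zs₂) ⟨
      sumℚ (map f (zs₁ ++ [ x ] ++ zs₂))                        ∎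
      where
      open ℚP.≤-Reasoning
      swap : ∀ a b c → a + (b + c) ≡ b + (a + c)
      swap = solve-∀ ℚ-ring
      xs⊆zs : ∀ {v} → v ∈ xs → v ∈ zs₁ ++ zs₂
      xs⊆zs {v} v∈xs with ∈-++⁻ zs₁ (xs⊆ys (there v∈xs))
      ... | inj₁ v∈zs₁         = ∈-++⁺ˡ v∈zs₁
      ... | inj₂ (here refl)   = ⊥-elim (All.lookup x∉xs v∈xs refl)
      ... | inj₂ (there v∈zs₂) = ∈-++⁺ʳ zs₁ v∈zs₂

sumℚ-applyDownFrom-mono : ∀ {g h : ℕ → ℚ} m → (∀ {i} → i ℕ.< m → g i ≤ h i) →
                          sumℚ (applyDownFrom g m) ≤ sumℚ (applyDownFrom h m)
sumℚ-applyDownFrom-mono zero    g≤h = ≤-refl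
sumℚ-applyDownFrom-mono (suc m) g≤h = +-mono-≤ (g≤h ℕP.≤-refl) (sumℚ-applyDownFrom-mono m (g≤h ∘ ℕP.m≤n⇒m≤1+n))

sumℚ-applyDownFrom-lower : ∀ {g : ℕ → ℚ} c m → (∀ {i} → i ℕ.< m → c ≤ g i) →
                           fromℕ m * c ≤ sumℚ (applyDownFrom g m)
sumℚ-applyDownFrom-lower c zero    c≤g = ≤-reflexive (ℚP.*-zeroˡ c)
sumℚ-applyDownFrom-lower c (suc m) c≤g = begin
  (1ℚ + fromℕ m) * c     ≡⟨ ℚP.*-distribʳ-+ c 1ℚ (fromℕ m) ⟩
  1ℚ * c + fromℕ m * c   ≡⟨ cong (λ s → s + fromℕ m * c) (ℚP.*-identityˡ c) ⟩
  c + fromℕ m * c        ≤⟨ +-mono-≤ (c≤g ℕP.≤-refl) (sumℚ-applyDownFrom-lower c m (c≤g ∘ ℕP.m≤n⇒m≤1+n)) ⟩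
  _                      ∎
  where open ℚP.≤-Reasoning

pt : ℕ → ℕ → ℕ → Pt
pt x y z = (+ x , + y , + z)

reflect : Sign → ℤ → ℤ
reflect Sign.+ z = z
reflect Sign.- z = ℤ.- z

reflect-abs : ∀ s z → ∣ reflect s z ∣ ≡ ∣ z ∣
reflect-abs Sign.+ z = refl
reflect-abs Sign.- z = ℤP.∣-i∣≡∣i∣ z

reflect-injective : ∀ s {x y} → reflect s x ≡ reflect s y → x ≡ y
reflect-injective Sign.+ x≡y = x≡y
reflect-injective Sign.- x≡y = ℤP.neg-injective x≡y

reflect-dist : ∀ s x y → ∣ reflect s x ℤ.- reflect s y ∣ ≡ ∣ x ℤ.- y ∣
reflect-dist Sign.+ x y = refl
reflect-dist Sign.- x y = trans (cong ∣_∣ (negate x y)) (ℤP.∣-i∣≡∣i∣ (x ℤ.- y))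
  where
  negate : ∀ x y → ℤ.- x ℤ.- ℤ.- y ≡ ℤ.- (x ℤ.- y)
  negate = ℤ-solve-∀

reflect-sign-abs : ∀ z → reflect (ℤ.sign z) (+ ∣ z ∣) ≡ z
reflect-sign-abs (+ m)    = refl
reflect-sign-abs -[1+ m ] = refl

-- A symmetry of ℤ³ preserving the ℓ¹ norm and the adjacency relation E' is an
-- automorphism of every G'_n; the cones below are built around a vertex with
-- non-negative coordinates and moved to an arbitrary vertex by a symmetry.
record Symmetry : Set where
  field
    act           : Pt → Pt
    act-norm      : ∀ v → norm1 (act v) ≡ norm1 v
    act-injective : ∀ {v w} → act v ≡ act w → v ≡ w
    act-adj       : ∀ {v w} → Adj v w → Adj (act v) (act w)

open Symmetry

_∘ˢ_ : Symmetry → Symmetry → Symmetry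
σ ∘ˢ τ = record
  { act           = act σ ∘ act τ
  ; act-norm      = λ v → trans (act-norm σ (act τ v)) (act-norm τ v)
  ; act-injective = act-injective τ ∘ act-injective σ
  ; act-adj       = act-adj σ ∘ act-adj τ
  }

reflectPt : Sign → Sign → Sign → Pt → Pt
reflectPt s₁ s₂ s₃ (x , y , z) = (reflect s₁ x , reflect s₂ y , reflect s₃ z)

swapPt : Pt → Pt
swapPt (x , y , z) = (y , x , z)

rotatePt : Pt → Pt
rotatePt (x , y , z) = (y , z , x)

reflectPt-injective : ∀ s₁ s₂ s₃ {v w} → reflectPt s₁ s₂ s₃ v ≡ reflectPt s₁ s₂ s₃ w → v ≡ w
reflectPt-injective s₁ s₂ s₃ {x , y , z} {x' , y' , z'} e =
  cong₂ _,_ (reflect-injective s₁ (cong proj₁ e))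
    (cong₂ _,_ (reflect-injective s₂ (cong (proj₁ ∘ proj₂) e)) (reflect-injective s₃ (cong (proj₂ ∘ proj₂) e)))

swapPt-injective : ∀ {v w} → swapPt v ≡ swapPt w → v ≡ w
swapPt-injective {x , y , z} {x' , y' , z'} refl = refl

rotatePt-injective : ∀ {v w} → rotatePt v ≡ rotatePt w → v ≡ w
rotatePt-injective {x , y , z} {x' , y' , z'} refl = refl

reflection : Sign → Sign → Sign → Symmetry
reflection s₁ s₂ s₃ = record
  { act           = reflectPt s₁ s₂ s₃
  ; act-norm      = λ { (x , y , z) → cong₂ ℕ._+_ (cong₂ ℕ._+_ (reflect-abs s₁ x) (reflect-abs s₂ y)) (reflect-abs s₃ z) }
  ; act-injective = reflectPt-injective s₁ s₂ s₃
  ; act-adj       = λ { {x , y , z} {x' , y' , z'} (v≢w , dx , dy , dz) →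
                        v≢w ∘ reflectPt-injective s₁ s₂ s₃
                      , subst (ℕ._≤ 1) (sym (reflect-dist s₁ x x')) dx
                      , subst (ℕ._≤ 1) (sym (reflect-dist s₂ y y')) dy
                      , subst (ℕ._≤ 1) (sym (reflect-dist s₃ z z')) dz }
  }

swap₁₂ : Symmetry
swap₁₂ = record
  { act           = swapPt
  ; act-norm      = λ { (x , y , z) → cong (ℕ._+ ∣ z ∣) (ℕP.+-comm (∣ y ∣) (∣ x ∣)) }
  ; act-injective = swapPt-injective
  ; act-adj       = λ { {_ , _ , _} {_ , _ , _} (v≢w , dx , dy , dz) → v≢w ∘ swapPt-injective , dy , dx , dz }
  }

rotate : Symmetry
rotate = record
  { act           = rotatePt
  ; act-norm      = λ { (x , y , z) → trans (ℕP.+-comm (∣ y ∣ ℕ.+ ∣ z ∣) (∣ x ∣)) (sym (ℕP.+-assoc (∣ x ∣) (∣ y ∣) (∣ z ∣))) }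
  ; act-injective = rotatePt-injective
  ; act-adj       = λ { {_ , _ , _} {_ , _ , _} (v≢w , dx , dy , dz) → v≢w ∘ rotatePt-injective , dy , dz , dx }
  }

module _ {n : ℕ} where

  walk-map : ∀ (σ : Symmetry) {v w k} → Walk n v w k → Walk n (act σ v) (act σ w) k
  walk-map σ here                 = here
  walk-map σ (step v∈V adj walk) = step (trans (act-norm σ _) v∈V) (act-adj σ adj) (walk-map σ walk)

  walk-end : ∀ {u w k} → Walk n u w (suc k) → InV n w
  walk-end (step w∈V _ here)          = w∈V
  walk-end (step _ _ walk@(step _ _ _)) = walk-end walk

  walk-zero : ∀ {u w} → Walk n u w 0 → u ≡ w
  walk-zero here = refl

recipSq-dist : ∀ {n u w d m} → IsDist n u w d → w ≢ u → Walk n u w (suc m) → recipSq (suc m) ≤ recipSq d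
recipSq-dist {d = zero}  (walk₀ , _) w≢u _    = ⊥-elim (w≢u (sym (walk-zero walk₀)))
recipSq-dist {d = suc d} (_ , minimal) _ walk = recipSq-antitone (ℕP.≤-pred (minimal _ walk))

∣suc-∣≤1 : ∀ m → ∣ + suc m ℤ.- + m ∣ ℕ.≤ 1
∣suc-∣≤1 m = ℕP.≤-reflexive (begin
  ∣ + suc m ℤ.- + m ∣  ≡⟨ cong ∣_∣ (ℤP.[+m]-[+n]≡m⊖n (suc m) m) ⟩
  ∣ suc m ⊖ m ∣        ≡⟨ ℤP.∣m⊖n∣≡∣n⊖m∣ (suc m) m ⟩
  ∣ m ⊖ suc m ∣        ≡⟨ ℤP.∣⊖∣-≤ (ℕP.n≤1+n m) ⟩
  suc m ∸ m            ≡⟨ ℕP.m+n∸n≡m 1 m ⟩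
  1                    ∎)
  where open ≡-Reasoning

∣-suc∣≤1 : ∀ m → ∣ + m ℤ.- + suc m ∣ ℕ.≤ 1
∣-suc∣≤1 m = subst (ℕ._≤ 1) (trans (cong ∣_∣ (ℤP.[+m]-[+n]≡m⊖n (suc m) m))
  (trans (ℤP.∣m⊖n∣≡∣n⊖m∣ (suc m) m) (cong ∣_∣ (sym (ℤP.[+m]-[+n]≡m⊖n m (suc m)))))) (∣suc-∣≤1 m)

∣z-z∣≤1 : ∀ z → ∣ z ℤ.- z ∣ ℕ.≤ 1
∣z-z∣≤1 z = subst (λ t → ∣ t ∣ ℕ.≤ 1) (sym (ℤP.+-inverseʳ z)) z≤n

adj-move₁₂ : ∀ x y z → Adj (pt (suc x) y z) (pt x (suc y) z)
adj-move₁₂ x y z = ℕP.1+n≢n ∘ ℤP.+-injective ∘ cong proj₁ , ∣suc-∣≤1 x , ∣-suc∣≤1 y , ∣z-z∣≤1 (+ z)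

adj-move₁₃ : ∀ x y z → Adj (pt (suc x) y z) (pt x y (suc z))
adj-move₁₃ x y z = ℕP.1+n≢n ∘ ℤP.+-injective ∘ cong proj₁ , ∣suc-∣≤1 x , ∣z-z∣≤1 (+ y) , ∣-suc∣≤1 z

transfer : ∀ {n} j k x y z → InV n (pt (j ℕ.+ k ℕ.+ x) y z) →
           Walk n (pt (j ℕ.+ k ℕ.+ x) y z) (pt x (j ℕ.+ y) (k ℕ.+ z)) (j ℕ.+ k)
transfer zero    zero    x y z _      = here
transfer {n} (suc j) k x y z start∈V = step next∈V (adj-move₁₂ (j ℕ.+ k ℕ.+ x) y z)
  (subst (λ t → Walk n (pt (j ℕ.+ k ℕ.+ x) (suc y) z) (pt x t (k ℕ.+ z)) (j ℕ.+ k)) (ℕP.+-suc j y)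
     (transfer j k x (suc y) z next∈V))
  where
  next∈V : InV n (pt (j ℕ.+ k ℕ.+ x) (suc y) z)
  next∈V = trans (cong (ℕ._+ z) (ℕP.+-suc (j ℕ.+ k ℕ.+ x) y)) start∈V
transfer {n} zero (suc k) x y z start∈V = step next∈V (adj-move₁₃ (k ℕ.+ x) y z)
  (subst (λ t → Walk n (pt (k ℕ.+ x) y (suc z)) (pt x y t) k) (ℕP.+-suc k z)
     (transfer zero k x y (suc z) next∈V))
  where
  next∈V : InV n (pt (k ℕ.+ x) y (suc z))
  next∈V = trans (ℕP.+-suc (k ℕ.+ x ℕ.+ y) z) start∈V

conePt : ℕ → ℕ → ℕ → ℕ → ℕ → Pt
conePt X Y Z i j = pt (X ∸ suc i) (j ℕ.+ Y) ((suc i ∸ j) ℕ.+ Z)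

cone-walk : ∀ {n X Y Z i j} → i ℕ.< X → j ℕ.≤ suc i → InV n (pt X Y Z) →
            Walk n (pt X Y Z) (conePt X Y Z i j) (suc i)
cone-walk {n} {X} {Y} {Z} {i} {j} i<X j≤1+i apex∈V =
  subst₂ (λ a t → Walk n (pt a Y Z) (conePt X Y Z i j) t) start length
    (transfer j (suc i ∸ j) (X ∸ suc i) Y Z (subst (λ a → InV n (pt a Y Z)) (sym start) apex∈V))
  where
  length : j ℕ.+ (suc i ∸ j) ≡ suc i
  length = ℕP.m+[n∸m]≡n j≤1+i
  start : j ℕ.+ (suc i ∸ j) ℕ.+ (X ∸ suc i) ≡ X
  start = trans (cong (ℕ._+ (X ∸ suc i)) length) (ℕP.m+[n∸m]≡n i<X)

range-member : ∀ {n} z → ∣ z ∣ ℕ.≤ n → z ∈ range n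
range-member {n} (+ m) m≤n = subst (_∈ range n) shift (∈-map⁺ (λ i → + i ℤ.- + n) (∈-upTo⁺ (s≤s bound)))
  where
  shift : + (m ℕ.+ n) ℤ.- + n ≡ + m
  shift = trans (ℤP.[+m]-[+n]≡m⊖n (m ℕ.+ n) n) (trans (ℤP.⊖-≥ (ℕP.m≤n+m n m)) (cong +_ (ℕP.m+n∸n≡m m n)))
  bound : m ℕ.+ n ℕ.≤ 2 ℕ.* n
  bound = ℕP.≤-trans (ℕP.+-monoˡ-≤ n m≤n) (ℕP.+-monoʳ-≤ n (ℕP.m≤m+n n 0))
range-member {n} -[1+ m ] 1+m≤n = subst (_∈ range n) shift (∈-map⁺ (λ i → + i ℤ.- + n) (∈-upTo⁺ (s≤s bound)))
  where
  shift : + (n ∸ suc m) ℤ.- + n ≡ -[1+ m ]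
  shift = trans (ℤP.[+m]-[+n]≡m⊖n (n ∸ suc m) n)
                (trans (ℤP.⊖-≤ (ℕP.m∸n≤m n (suc m))) (cong (λ t → ℤ.- + t) (ℕP.m∸[m∸n]≡n 1+m≤n)))
  bound : n ∸ suc m ℕ.≤ 2 ℕ.* n
  bound = ℕP.≤-trans (ℕP.m∸n≤m n (suc m)) (ℕP.m≤m+n n (n ℕ.+ 0))

Vminus-member : ∀ {n u w} → InV n w → w ≢ u → w ∈ Vminus n u
Vminus-member {n} {u} {w@(a , b , c)} w∈V w≢u =
  ∈-filter⁺ (λ v → ¬? (v ≟Pt u)) (∈-filter⁺ (λ v → norm1 v ℕ.≟ n) w∈box w∈V) w≢u
  where
  a≤n : ∣ a ∣ ℕ.≤ n
  a≤n = subst (_ ℕ.≤_) w∈V (ℕP.≤-trans (ℕP.m≤m+n (∣ a ∣) (∣ b ∣)) (ℕP.m≤m+n _ (∣ c ∣)))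
  b≤n : ∣ b ∣ ℕ.≤ n
  b≤n = subst (_ ℕ.≤_) w∈V (ℕP.≤-trans (ℕP.m≤n+m (∣ b ∣) (∣ a ∣)) (ℕP.m≤m+n _ (∣ c ∣)))
  c≤n : ∣ c ∣ ℕ.≤ n
  c≤n = subst (_ ℕ.≤_) w∈V (ℕP.m≤n+m (∣ c ∣) _)
  w∈box : w ∈ box n
  w∈box = ∈-concatMap⁺ (λ x → concatMap (λ y → map (λ z → (x , y , z)) (range n)) (range n))
            (lose (range-member a a≤n) (∈-concatMap⁺ (λ y → map (λ z → (a , y , z)) (range n))
              (lose (range-member b b≤n) (∈-map⁺ (λ z → (a , b , z)) (range-member c c≤n)))))

separated : ∀ {xs ys : List Pt} (g : Pt → ℕ) m →
            (∀ {v} → v ∈ xs → g v ℕ.< m) → (∀ {v} → v ∈ ys → m ℕ.≤ g v) → Disjoint xs ys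
separated g m below above (v∈xs , v∈ys) = ℕP.<⇒≱ (below v∈xs) (above v∈ys)

-- The cone of height X below the vertex σ (X, Y, Z): its i-th shell (i < X) consists of
-- the i + 2 images of the cone points (i, j), j ≤ i + 1.  The shells are pairwise
-- disjoint because the first coordinate X ∸ (i + 1) determines i, and within a shell
-- the second coordinate j + Y determines j.
module Cone (σ : Symmetry) (X Y Z : ℕ) where

  shell : ℕ → List Pt
  shell i = applyDownFrom (λ j → act σ (conePt X Y Z i j)) (suc (suc i))

  cone : List Pt
  cone = concat (applyDownFrom shell X)

  shell-member : ∀ {i v} → v ∈ shell i → ∃ λ j → j ℕ.≤ suc i × v ≡ act σ (conePt X Y Z i j)
  shell-member v∈ with j , j<2+i , v≡ ← ∈-applyDownFrom⁻ _ v∈ = j , ℕP.≤-pred j<2+i , v≡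

  cone-member : ∀ {v} → v ∈ cone → ∃₂ λ i j → i ℕ.< X × j ℕ.≤ suc i × v ≡ act σ (conePt X Y Z i j)
  cone-member v∈
    with xs , v∈xs , xs∈ ← ∈-concat⁻′ (applyDownFrom shell X) v∈
    with i , i<X , refl ← ∈-applyDownFrom⁻ shell xs∈
    with j , j≤1+i , v≡ ← shell-member v∈xs
    = i , j , i<X , j≤1+i , v≡

  cone-unique : Unique cone
  cone-unique = Unique.concat⁺ (AllP.applyDownFrom⁺₂ shell X shell-unique)
                               (AllPairsP.applyDownFrom⁺₁ shell X shells-disjoint)
    where
    shell-unique : ∀ i → Unique (shell i)
    shell-unique i = Unique.applyDownFrom⁺₁ _ (suc (suc i)) λ j'<j _ e →
      ℕP.<⇒≢ j'<j (sym (ℕP.+-cancelʳ-≡ Y _ _ (ℤP.+-injective (cong (proj₁ ∘ proj₂) (act-injective σ e)))))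
    shells-disjoint : ∀ {i i'} → i' ℕ.< i → i ℕ.< X → Disjoint (shell i) (shell i')
    shells-disjoint i'<i i<X (v∈ , v∈')
      with _ , _ , refl ← shell-member v∈
      with _ , _ , e ← shell-member v∈'
      = ℕP.<⇒≢ (ℕP.∸-monoʳ-< (s≤s i'<i) i<X) (ℤP.+-injective (cong proj₁ (act-injective σ e)))

  -- Placed at a vertex u of G'_n, the cone consists of vertices other than u; those in
  -- shell i are at distance at most i + 1, so the cone contributes at least coneBound X.
  module _ {n u} (u∈V : InV n u) (apex≡u : act σ (pt X Y Z) ≡ u) where

    apex∈V : InV n (pt X Y Z)
    apex∈V = trans (sym (act-norm σ (pt X Y Z))) (trans (cong norm1 apex≡u) u∈V)

    conePt-walk : ∀ {i j} → i ℕ.< X → j ℕ.≤ suc i → Walk n u (act σ (conePt X Y Z i j)) (suc i)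
    conePt-walk i<X j≤1+i = subst (λ v → Walk n v _ _) apex≡u (walk-map σ (cone-walk i<X j≤1+i apex∈V))

    conePt-≢ : ∀ {i j} → i ℕ.< X → act σ (conePt X Y Z i j) ≢ u
    conePt-≢ i<X e = ℕP.<⇒≢ (ℕP.∸-monoʳ-< (s≤s z≤n) i<X)
      (ℤP.+-injective (cong proj₁ (act-injective σ (trans e (sym apex≡u)))))

    cone-⊆ : ∀ {v} → v ∈ cone → v ∈ Vminus n u
    cone-⊆ v∈ with _ , _ , i<X , j≤1+i , refl ← cone-member v∈ =
      Vminus-member (walk-end (conePt-walk i<X j≤1+i)) (conePt-≢ i<X)

    cone-weight : (d : Pt → ℕ) → (∀ w → InV n w → IsDist n u w (d w)) →
                  coneBound X ≤ sumℚ (map (λ w → recipSq (d w)) cone)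
    cone-weight d dist = begin
      coneBound X                                        ≤⟨ sumℚ-applyDownFrom-mono X shell-weight ⟩
      sumℚ (applyDownFrom (sumℚ ∘ map f ∘ shell) X)      ≡⟨ cong sumℚ (LP.map-applyDownFrom shell (sumℚ ∘ map f) X) ⟨
      sumℚ (map (sumℚ ∘ map f) (applyDownFrom shell X))  ≡⟨ sumℚ-concat f (applyDownFrom shell X) ⟨
      sumℚ (map f cone)                                  ∎
      where
      open ℚP.≤-Reasoning
      f : Pt → ℚ
      f w = recipSq (d w)
      point-weight : ∀ {i j} → i ℕ.< X → j ℕ.≤ suc i → recipSq (suc i) ≤ f (act σ (conePt X Y Z i j))
      point-weight i<X j≤1+i = recipSq-dist (dist _ (walk-end walk)) (conePt-≢ i<X) walk
        where walk = conePt-walk i<X j≤1+i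
      shell-weight : ∀ {i} → i ℕ.< X → shellWeight i ≤ sumℚ (map f (shell i))
      shell-weight {i} i<X = subst (shellWeight i ≤_) (sym (cong sumℚ (LP.map-applyDownFrom _ f (suc (suc i)))))
        (sumℚ-applyDownFrom-lower (recipSq (suc i)) (suc (suc i)) (λ j<2+i → point-weight i<X (ℕP.≤-pred j<2+i)))

-- With ρ reflecting coordinates
-- by the signs of a, b, c, the vertex u is the image of (A, B, C), (B, A, C) and
-- (C, A, B) under ρ, ρ ∘ swap₁₂ and ρ ∘ rotate respectively.  The cones are disjoint:
-- |first coordinate| is < A on the first cone and ≥ A on the others, and
-- |second coordinate| is < B on the second cone and ≥ B on the third.
module ThreeCones (a b c : ℤ) where

  A B C : ℕ
  A = ∣ a ∣
  B = ∣ b ∣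
  C = ∣ c ∣

  ρ : Symmetry
  ρ = reflection (ℤ.sign a) (ℤ.sign b) (ℤ.sign c)

  module Cone₁ = Cone ρ A B C
  module Cone₂ = Cone (ρ ∘ˢ swap₁₂) B A C
  module Cone₃ = Cone (ρ ∘ˢ rotate) C A B

  cones : List Pt
  cones = Cone₁.cone ++ Cone₂.cone ++ Cone₃.cone

  ρ-apex : act ρ (pt A B C) ≡ (a , b , c)
  ρ-apex = cong₂ _,_ (reflect-sign-abs a) (cong₂ _,_ (reflect-sign-abs b) (reflect-sign-abs c))

  coord₁ coord₂ : Pt → ℕ
  coord₁ v = ∣ proj₁ v ∣
  coord₂ v = ∣ proj₁ (proj₂ v) ∣

  coord₁-cone₁ : ∀ {v} → v ∈ Cone₁.cone → coord₁ v ℕ.< A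
  coord₁-cone₁ v∈ with i , _ , i<A , _ , refl ← Cone₁.cone-member v∈ =
    subst (ℕ._< A) (sym (reflect-abs (ℤ.sign a) _)) (ℕP.∸-monoʳ-< (s≤s z≤n) i<A)

  coord₁-cone₂₃ : ∀ {v} → v ∈ Cone₂.cone ++ Cone₃.cone → A ℕ.≤ coord₁ v
  coord₁-cone₂₃ v∈ with ∈-++⁻ Cone₂.cone v∈
  ... | inj₁ v∈₂ with _ , j , _ , _ , refl ← Cone₂.cone-member v∈₂ =
    subst (A ℕ.≤_) (sym (reflect-abs (ℤ.sign a) _)) (ℕP.m≤n+m A j)
  ... | inj₂ v∈₃ with _ , j , _ , _ , refl ← Cone₃.cone-member v∈₃ =
    subst (A ℕ.≤_) (sym (reflect-abs (ℤ.sign a) _)) (ℕP.m≤n+m A j)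

  coord₂-cone₂ : ∀ {v} → v ∈ Cone₂.cone → coord₂ v ℕ.< B
  coord₂-cone₂ v∈ with i , _ , i<B , _ , refl ← Cone₂.cone-member v∈ =
    subst (ℕ._< B) (sym (reflect-abs (ℤ.sign b) _)) (ℕP.∸-monoʳ-< (s≤s z≤n) i<B)

  coord₂-cone₃ : ∀ {v} → v ∈ Cone₃.cone → B ℕ.≤ coord₂ v
  coord₂-cone₃ v∈ with i , j , _ , _ , refl ← Cone₃.cone-member v∈ =
    subst (B ℕ.≤_) (sym (reflect-abs (ℤ.sign b) _)) (ℕP.m≤n+m B (suc i ∸ j))

  cones-unique : Unique cones
  cones-unique = Unique.++⁺ Cone₁.cone-unique
    (Unique.++⁺ Cone₂.cone-unique Cone₃.cone-unique (separated coord₂ B coord₂-cone₂ coord₂-cone₃))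
    (separated coord₁ A coord₁-cone₁ coord₁-cone₂₃)

  cones-weight : ∀ {n} → InV n (a , b , c) → (d : Pt → ℕ) → (∀ w → InV n w → IsDist n (a , b , c) w (d w)) →
                 coneBound A + (coneBound B + coneBound C) ≤ sumℚ (map (λ w → recipSq (d w)) (Vminus n (a , b , c)))
  cones-weight {n} u∈V d dist = begin
    coneBound A + (coneBound B + coneBound C)
      ≤⟨ +-mono-≤ (Cone₁.cone-weight u∈V ρ-apex d dist)
           (+-mono-≤ (Cone₂.cone-weight u∈V ρ-apex d dist) (Cone₃.cone-weight u∈V ρ-apex d dist)) ⟩
    sumℚ (map f Cone₁.cone) + (sumℚ (map f Cone₂.cone) + sumℚ (map f Cone₃.cone))
      ≡⟨ cong (λ s → sumℚ (map f Cone₁.cone) + s) (sumℚ-++ f Cone₂.cone Cone₃.cone) ⟨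
    sumℚ (map f Cone₁.cone) + sumℚ (map f (Cone₂.cone ++ Cone₃.cone))
      ≡⟨ sumℚ-++ f Cone₁.cone (Cone₂.cone ++ Cone₃.cone) ⟨
    sumℚ (map f cones)
      ≤⟨ sumℚ-⊆ f (λ w → recipSq-nonNeg (d w)) cones-unique cones-⊆ ⟩
    sumℚ (map f (Vminus n (a , b , c))) ∎
    where
    open ℚP.≤-Reasoning
    f : Pt → ℚ
    f w = recipSq (d w)
    cones-⊆ : ∀ {v} → v ∈ cones → v ∈ Vminus n (a , b , c)
    cones-⊆ v∈ with ∈-++⁻ Cone₁.cone v∈
    ... | inj₁ v∈₁ = Cone₁.cone-⊆ u∈V ρ-apex v∈₁
    ... | inj₂ v∈₂₃ with ∈-++⁻ Cone₂.cone v∈₂₃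
    ...   | inj₁ v∈₂ = Cone₂.cone-⊆ u∈V ρ-apex v∈₂
    ...   | inj₂ v∈₃ = Cone₃.cone-⊆ u∈V ρ-apex v∈₃

lemma3 : (n : ℕ) → 1 ℕ.≤ n → (u : Pt) → InV n u → (d : Pt → ℕ) → (∀ w → InV n w → IsDist n u w (d w)) →
         LnLt (suc n) (sumℚ (map (λ w → recipSq (d w)) (Vminus n u)))
lemma3 n 1≤n (a , b , c) u∈V d dist =
  subst (λ m → LnLt (suc m) Zu⁻¹) u∈V
    (ln-bound A B C Zu⁻¹ (subst (1 ℕ.≤_) (sym u∈V) 1≤n) (cones-weight u∈V d dist))
  where
  open ThreeCones a b c
  Zu⁻¹ : ℚ
  Zu⁻¹ = sumℚ (map (λ w → recipSq (d w)) (Vminus n (a , b , c)))
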